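{- Let $(L,\preceq)$ be a finite lattice and let isotone maps $f:L\to L$ be given as oracles. There is a deterministic algorithm that decides whether $f$ has at least two fixed points using $\mathcal O(h(L,\preceq))$ queries.
   Context: A map $f$ is isotone if $x\preceq y$ implies $f(x)\preceq f(y)$. $h(L,\preceq)$ is the height (maximum length $|C|-1$ of a chain $C$). In the oracle model, the algorithm learns about $f$ only by querying values $f(x)$, and its cost is the number of queries. -}

module Defs where

open import Data.Nat using (ℕ; zero; suc)
open import Data.Fin using (Fin; inject₁) renaming (suc to fsuc)
open import Data.Bool using (Bool)
open import Data.Product using (Σ; _×_)
open import Relation.Binary.Core using (Rel)
open import Relation.Binary.PropositionalEquality using (_≡_; _≢_)
open import Relation.Binary.Lattice.Structures using (IsLattice)
open import Level using (0ℓ)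

-- A finite lattice, presented (up to isomorphism) on the carrier Fin n,
-- with equality being propositional equality.
record FiniteLattice : Set₁ where
  field
    size : ℕ
    _≤_  : Rel (Fin size) 0ℓ
    _∨_  : Fin size → Fin size → Fin size
    _∧_  : Fin size → Fin size → Fin size
    isLattice : IsLattice _≡_ _≤_ _∨_ _∧_

module _ (L : FiniteLattice) where
  open FiniteLattice L

  Elt : Set
  Elt = Fin size

  _≺_ : Elt → Elt → Set
  x ≺ y = (x ≤ y) × (x ≢ y)

  -- a chain with k+1 elements (hence of length k): x₀ ≺ x₁ ≺ … ≺ x_k
  IsChain : (k : ℕ) → (Fin (suc k) → Elt) → Set
  IsChain k c = (i : Fin k) → c (inject₁ i) ≺ c (fsuc i)

  HasHeight : ℕ → Set
  HasHeight h = Σ (Fin (suc h) → Elt) (IsChain h)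
              × (∀ k (c : Fin (suc k) → Elt) → IsChain k c → k Data.Nat.≤ h)

  Isotone : (Elt → Elt) → Set
  Isotone f = ∀ x y → x ≤ y → f x ≤ f y

  AtLeastTwoFixedPoints : (Elt → Elt) → Set
  AtLeastTwoFixedPoints f =
    Σ Elt λ x → Σ Elt λ y → (x ≢ y) × (f x ≡ x) × (f y ≡ y)

-- Deterministic oracle algorithms (decision trees) over a set X of points:
-- either output an answer, or query f at a point and continue adaptively
-- depending on the answer.
data Alg (X : Set) : Set where
  done  : Bool → Alg X
  query : X → (X → Alg X) → Alg X

run : {X : Set} → Alg X → (X → X) → Bool
run (done b)    f = b
run (query x k) f = run (k (f x)) f

cost : {X : Set} → Alg X → (X → X) → ℕ
cost (done b)    f = zero
cost (query x k) f = suc (cost (k (f x)) f)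

{-# OPTIONS --safe #-}
module Submission where

-- Kleene iteration from the bottom, x, f x, f (f x), …, climbs a strictly
-- increasing chain until it reaches the least fixed point, so it takes at most
-- h + 1 queries; dually, iteration from the top reaches the greatest fixed
-- point. Since every fixed point lies between the two, f has at least two
-- fixed points exactly when the least and the greatest one differ.

open import Defs
open import Data.Bool using (true; false; if_then_else_)
open import Data.Empty using (⊥-elim)
open import Data.Fin using (Fin; inject₁; opposite; _≟_) renaming (zero to fzero; suc to fsuc)
open import Data.Nat using (ℕ; zero; suc; _≤_; _<_; _+_; _*_; s≤s; s≤s⁻¹)
open import Data.Nat.Properties using (m≤n+m; n≮0; +-monoʳ-≤; module ≤-Reasoning)
open import Data.Nat.Tactic.RingSolver using (solve-∀)
open import Data.Product using (Σ; Σ-syntax; _×_; _,_; proj₁; proj₂)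
open import Data.Vec.Functional using (Vector; _∷_; foldr; reverse)
open import Function.Base using (id; flip)
open import Function.Bundles using (_⇔_; mk⇔)
open import Function.Properties.Equivalence using () renaming (trans to ⇔-trans)
open import Relation.Binary.Lattice using (IsLattice)
import Relation.Binary.Lattice.Properties.Lattice as LatticeProperties
open import Relation.Binary.PropositionalEquality using (_≡_; _≢_; refl; sym; cong; subst)
import Relation.Binary.PropositionalEquality as ≡
open import Relation.Nullary using (Dec; yes; no; does; ¬?)

kleene : {n : ℕ} → ℕ → Fin n → (Fin n → Alg (Fin n)) → Alg (Fin n)
kleene zero    x k = done false  -- never reached when the budget exceeds the height
kleene (suc m) x k = query x λ y → if does (y ≟ x) then k x else kleene m y k

decideDistinct : {n : ℕ} → Fin n → Fin n → Alg (Fin n)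
decideDistinct a b = done (does (¬? (a ≟ b)))

does≡true⇔ : ∀ {P : Set} (d : Dec P) → does d ≡ true ⇔ P
does≡true⇔ (yes p)  = mk⇔ (λ _ → p) (λ _ → refl)
does≡true⇔ (no ¬p) = mk⇔ (λ ()) (λ p → ⊥-elim (¬p p))

opposite-inject₁ : ∀ {n} (i : Fin n) → opposite (inject₁ i) ≡ fsuc (opposite i)
opposite-inject₁ {suc n} fzero    = refl
opposite-inject₁ {suc n} (fsuc i) = cong inject₁ (opposite-inject₁ i)

dual : FiniteLattice → FiniteLattice
dual L = record
  { size      = size
  ; _≤_       = flip _⊑_
  ; _∨_       = _∧_
  ; _∧_       = _∨_
  ; isLattice = LatticeProperties.∧-∨-isLattice (record { isLattice = isLattice })
  }
  where open FiniteLattice L renaming (_≤_ to _⊑_)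

module _ (L : FiniteLattice) where
  open FiniteLattice L renaming (_≤_ to _⊑_)
  open IsLattice isLattice using (x∧y≤x; x∧y≤y) renaming (trans to ⊑-trans)

  HeightAtMost : ℕ → Set
  HeightAtMost h = ∀ k c → IsChain L k c → k ≤ h

  BelowFixedPoints : (Elt L → Elt L) → Elt L → Set
  BelowFixedPoints f x = ∀ p → f p ≡ p → x ⊑ p

  IsLeastFixedPoint : (Elt L → Elt L) → Elt L → Set
  IsLeastFixedPoint f a = f a ≡ a × BelowFixedPoints f a

  ContinuesWithLeastFixedPoint : (Elt L → Elt L) → Alg (Elt L) → ℕ → (Elt L → Alg (Elt L)) → Set
  ContinuesWithLeastFixedPoint f A m k =
    Σ[ a ∈ Elt L ] IsLeastFixedPoint f a × run A f ≡ run (k a) f × cost A f ≤ m + cost (k a) f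

  -- The seed e is only the value of the empty meet, needed because the carrier
  -- Fin size is not known to be inhabited.
  ⋀ : Elt L → ∀ {m} → Vector (Elt L) m → Elt L
  ⋀ e = foldr _∧_ e

  ⋀-lowerBound : ∀ e {m} (v : Vector (Elt L) m) i → ⋀ e v ⊑ v i
  ⋀-lowerBound e v fzero    = x∧y≤x _ _
  ⋀-lowerBound e v (fsuc i) = ⊑-trans (x∧y≤y _ _) (⋀-lowerBound e (λ j → v (fsuc j)) i)

  bottom : Elt L → Elt L
  bottom e = ⋀ e id

  bottom-least : ∀ e x → bottom e ⊑ x
  bottom-least e = ⋀-lowerBound e id

  ∷-isChain : ∀ {j} x (c : Fin (suc j) → Elt L) →
              _≺_ L x (c fzero) → IsChain L j c → IsChain L (suc j) (x ∷ c)
  ∷-isChain x c x≺c₀ chain fzero    = x≺c₀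
  ∷-isChain x c x≺c₀ chain (fsuc i) = chain i

  ChainsFromShorterThan : Elt L → ℕ → Set
  ChainsFromShorterThan x m = ∀ j c → IsChain L j c → c fzero ≡ x → j < m

  chainsFrom-shorten : ∀ {x y m} → ChainsFromShorterThan x (suc m) → _≺_ L x y → ChainsFromShorterThan y m
  chainsFrom-shorten short x≺y j c chain refl = s≤s⁻¹ (short (suc j) (_ ∷ c) (∷-isChain _ c x≺y chain) refl)

  module _ {f : Elt L → Elt L} (isotone : Isotone L f) where

    BelowFixedPoints-image : ∀ x → BelowFixedPoints f x → BelowFixedPoints f (f x)
    BelowFixedPoints-image x x⊑fix p fp≡p = subst (f x ⊑_) fp≡p (isotone x p (x⊑fix p fp≡p))

    kleene-reaches-lfp : (k : Elt L → Alg (Elt L)) → ∀ m x → x ⊑ f x → BelowFixedPoints f x →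
      ChainsFromShorterThan x m → ContinuesWithLeastFixedPoint f (kleene m x k) m k
    kleene-reaches-lfp k zero x _ _ short = ⊥-elim (n≮0 (short 0 (λ _ → x) (λ ()) refl))
    kleene-reaches-lfp k (suc m) x x⊑fx x⊑fix short with f x ≟ x
    ... | yes fx≡x = x , (fx≡x , x⊑fix) , refl , s≤s (m≤n+m _ m)
    ... | no fx≢x
      with kleene-reaches-lfp k m (f x) (isotone x (f x) x⊑fx) (BelowFixedPoints-image x x⊑fix)
             (chainsFrom-shorten short (x⊑fx , λ x≡fx → fx≢x (sym x≡fx)))
    ...   | a , lfp , run≡ , cost≤ = a , lfp , run≡ , s≤s cost≤

    kleene-from-bottom : ∀ {h} → HeightAtMost h → ∀ e (k : Elt L → Alg (Elt L)) →
      ContinuesWithLeastFixedPoint f (kleene (suc h) (bottom e) k) (suc h) k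
    kleene-from-bottom {h} height e k = kleene-reaches-lfp k (suc h) (bottom e)
      (bottom-least e _) (λ p _ → bottom-least e p) (λ j c chain _ → s≤s (height j c chain))

IsGreatestFixedPoint : (L : FiniteLattice) → (Elt L → Elt L) → Elt L → Set
IsGreatestFixedPoint L = IsLeastFixedPoint (dual L)

top : (L : FiniteLattice) → Elt L → Elt L
top L = bottom (dual L)

module _ (L : FiniteLattice) where
  open FiniteLattice L renaming (_≤_ to _⊑_)
  open IsLattice isLattice using (antisym)

  reverse-isChain : ∀ {j} (c : Fin (suc j) → Elt L) → IsChain (dual L) j c → IsChain L j (reverse c)
  reverse-isChain c chain i rewrite opposite-inject₁ i =
    let c₊⊑c , c≢c₊ = chain (opposite i) in c₊⊑c , λ c₊≡c → c≢c₊ (sym c₊≡c)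

  heightAtMost-dual : ∀ {h} → HeightAtMost L h → HeightAtMost (dual L) h
  heightAtMost-dual height j c chain = height j (reverse c) (reverse-isChain c chain)

  isotone-dual : ∀ {f} → Isotone L f → Isotone (dual L) f
  isotone-dual isotone x y y⊑x = isotone y x y⊑x

  lfp≢gfp⇔atLeastTwoFixedPoints : ∀ {f a b} → IsLeastFixedPoint L f a → IsGreatestFixedPoint L f b →
                                   a ≢ b ⇔ AtLeastTwoFixedPoints L f
  lfp≢gfp⇔atLeastTwoFixedPoints {a = a} {b} (fa≡a , a⊑fix) (fb≡b , fix⊑b) = mk⇔ distinct collapse
    where
    distinct : a ≢ b → AtLeastTwoFixedPoints L _
    distinct a≢b = a , b , a≢b , fa≡a , fb≡b
    collapse : AtLeastTwoFixedPoints L _ → a ≢ b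
    collapse (x , y , x≢y , fx≡x , fy≡y) refl = x≢y (≡.trans (sym (squeeze x fx≡x)) (squeeze y fy≡y))
      where
      squeeze : ∀ p → _ ≡ p → a ≡ p
      squeeze p fp≡p = antisym (a⊑fix p fp≡p) (fix⊑b p fp≡p)

module _ (L : FiniteLattice) (h : ℕ) (height : HasHeight L h) where

  private
    seed : Elt L
    seed = proj₁ (proj₁ height) fzero

  twoFixedPoints? : Alg (Elt L)
  twoFixedPoints? =
    kleene (suc h) (bottom L seed) λ lfp → kleene (suc h) (top L seed) (decideDistinct lfp)

  twoFixedPoints?-correct : ∀ f → Isotone L f →
    ((run twoFixedPoints? f ≡ true) ⇔ AtLeastTwoFixedPoints L f) × (cost twoFixedPoints? f ≤ 2 * h + 2)
  twoFixedPoints?-correct f isotone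
    with kleene-from-bottom L isotone (proj₂ height) seed
           (λ a → kleene (suc h) (top L seed) (decideDistinct a))
  ... | a , lfp , run₁ , cost₁
    with kleene-from-bottom (dual L) (isotone-dual L isotone) (heightAtMost-dual L (proj₂ height)) seed
           (decideDistinct a)
  ... | b , gfp , run₂ , cost₂ = answer , bound
    where
    answer : run twoFixedPoints? f ≡ true ⇔ AtLeastTwoFixedPoints L f
    answer = subst (λ r → r ≡ true ⇔ AtLeastTwoFixedPoints L f) (sym (≡.trans run₁ run₂))
      (⇔-trans (does≡true⇔ (¬? (a ≟ b))) (lfp≢gfp⇔atLeastTwoFixedPoints L lfp gfp))

    bound : cost twoFixedPoints? f ≤ 2 * h + 2
    bound = begin
      cost twoFixedPoints? f  ≤⟨ cost₁ ⟩
      suc h + _               ≤⟨ +-monoʳ-≤ (suc h) cost₂ ⟩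
      suc h + (suc h + 0)     ≡⟨ twice h ⟩
      2 * h + 2               ∎
      where
      open ≤-Reasoning
      twice : ∀ n → suc n + (suc n + 0) ≡ 2 * n + 2
      twice = solve-∀

proposition7 : Σ ℕ λ c → (L : FiniteLattice) → (h : ℕ) → HasHeight L h →
    Σ (Alg (Elt L)) λ A → (f : Elt L → Elt L) → Isotone L f →
      ((run A f ≡ true) ⇔ AtLeastTwoFixedPoints L f) × (cost A f ≤ c * h + c)
proposition7 = 2 , λ L h height → twoFixedPoints? L h height , twoFixedPoints?-correct L h height
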